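{- Let $m\geqslant 2$ and $n_1,n_2\geqslant 1$ be integers such that $q_1=1+mn_1$ and $q_2=1+mn_2$ are prime powers, and let $\alpha_1,\alpha_2$ be primitive elements of $\operatorname{GF}(q_1)$, $\operatorname{GF}(q_2)$. Then the graph $\Gamma_m(\alpha_1,\alpha_2)$ is undirected if and only if $q_1n_1\equiv q_2n_2\pmod 2$.
   Context: Let $\mathsf C_1(\alpha_1) = \{(\alpha_1^k,0): 0\le k\le q_1-2\}$ and $\mathsf D_0(\alpha_1,\alpha_2) = \{(\alpha_1^{i_1},\alpha_2^{i_2}) : i_1\equiv i_2 \pmod m\}$ in the additive group $\operatorname{GF}(q_1)\times\operatorname{GF}(q_2)$. $\Gamma_m(\alpha_1,\alpha_2)$ is the Cayley digraph on this group with connection set $S=\mathsf C_1(\alpha_1)\cup\mathsf D_0(\alpha_1,\alpha_2)$, i.e. arcs $(g,s+g)$ for $g$ in the group and $s\in S$; it is undirected when its arc relation is symmetric. -}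

module Defs where

open import Level using (0ℓ)
open import Data.Nat using (ℕ; zero; suc; _∸_; _<_; _≤_; _^_)
open import Data.Nat.Primality using (Prime)
open import Data.Fin using (Fin)
open import Data.Integer using (ℤ; +_)
import Data.Integer as ℤ
open import Data.Integer.Divisibility using () renaming (_∣_ to _∣ℤ_)
open import Data.Product using (Σ; ∃; ∃-syntax; _×_; _,_)
open import Data.Sum using (_⊎_)
open import Relation.Nullary using (¬_)
open import Relation.Binary.PropositionalEquality using (_≡_)
open import Algebra.Bundles using (CommutativeRing)

IsPrimePower : ℕ → Set
IsPrimePower q = ∃[ p ] ∃[ k ] (Prime p × 1 ≤ k × q ≡ p ^ k)

_≡_[mod_] : ℕ → ℕ → ℕ → Set
a ≡ b [mod m ] = (+ m) ∣ℤ ((+ a) ℤ.- (+ b))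

record FiniteField (q : ℕ) : Set₁ where
  field
    commRing : CommutativeRing 0ℓ 0ℓ
  open CommutativeRing commRing public
  field
    1≉0     : ¬ (1# ≈ 0#)
    inverse : ∀ x → ¬ (x ≈ 0#) → ∃[ y ] (x * y ≈ 1#)
    enum    : Fin q → Carrier
    enum-injective  : ∀ i j → enum i ≈ enum j → i ≡ j
    enum-surjective : ∀ x → ∃[ i ] (enum i ≈ x)

  pow : Carrier → ℕ → Carrier
  pow x zero    = 1#
  pow x (suc k) = x * pow x k

  IsPrimitive : Carrier → Set
  IsPrimitive α = ∀ x → ¬ (x ≈ 0#) → ∃[ k ] (x ≈ pow α k)

module _ {q₁ q₂ : ℕ} (F₁ : FiniteField q₁) (F₂ : FiniteField q₂) where
  private
    module F₁ = FiniteField F₁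
    module F₂ = FiniteField F₂

  Elt : Set
  Elt = F₁.Carrier × F₂.Carrier

  _≈G_ : Elt → Elt → Set
  (x₁ , x₂) ≈G (y₁ , y₂) = (x₁ F₁.≈ y₁) × (x₂ F₂.≈ y₂)

  _+G_ : Elt → Elt → Elt
  (x₁ , x₂) +G (y₁ , y₂) = (x₁ F₁.+ y₁) , (x₂ F₂.+ y₂)

  InC₁ : F₁.Carrier → Elt → Set
  InC₁ α₁ (x₁ , x₂) = ∃[ k ] (k ≤ q₁ ∸ 2 × x₁ F₁.≈ F₁.pow α₁ k × x₂ F₂.≈ F₂.0#)

  InD₀ : ℕ → F₁.Carrier → F₂.Carrier → Elt → Set
  InD₀ m α₁ α₂ (x₁ , x₂) =
    ∃[ i₁ ] ∃[ i₂ ] (i₁ ≡ i₂ [mod m ] × x₁ F₁.≈ F₁.pow α₁ i₁ × x₂ F₂.≈ F₂.pow α₂ i₂)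

  InS : ℕ → F₁.Carrier → F₂.Carrier → Elt → Set
  InS m α₁ α₂ x = InC₁ α₁ x ⊎ InD₀ m α₁ α₂ x

  Arc : ℕ → F₁.Carrier → F₂.Carrier → Elt → Elt → Set
  Arc m α₁ α₂ g h = ∃[ s ] (InS m α₁ α₂ s × h ≈G (s +G g))

  Undirected : ℕ → F₁.Carrier → F₂.Carrier → Set
  Undirected m α₁ α₂ = ∀ g h → Arc m α₁ α₂ g h → Arc m α₁ α₂ h g

{-# OPTIONS --safe #-}
module Submission where

open import Defs
open import Data.Nat using (ℕ; _+_; _*_; _≤_; _%_)
open import Data.Product using (_×_)
open import Relation.Binary.PropositionalEquality using (_≡_)
open import Function.Bundles using (_⇔_)

import Algebra.Properties.Ring as RingProperties
open import Data.Empty using (⊥-elim)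
open import Data.Fin as Fin using (Fin; zero; suc; toℕ; fromℕ<)
import Data.Fin.Properties as Fin
open import Data.Integer using (+_)
import Data.Integer as ℤ
import Data.Integer.Properties as ℤ
open import Data.Nat using (zero; suc; _∸_; _<_; _/_; NonZero; >-nonZero; z<s; s≤s; s≤s⁻¹)
open import Data.Nat.Coprimality using (Coprime; 1-coprimeTo; coprime-+; coprime-divisor)
open import Data.Nat.Divisibility using (_∣_; divides; m∣m*n; m%n≡0⇒n∣m; n∣m⇒m%n≡0)
open import Data.Nat.DivMod
open import Data.Nat.Properties
  using ( *-cancelʳ-≡; *-distribʳ-+; *-distribʳ-∸; *-distribˡ-+; *-mono-≤; +-suc; <-trans; <⇒≤; <⇒≱
        ; [m+n]∸[m+o]≡n∸o; m+[n∸m]≡n; m<m+n; m<n⇒0<n∸m; m∸n+n≡m; m∸n≤m; n<1+n; ∸-monoˡ-≤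
        ; ≤-antisym; ≤-total; ≤-trans; ≮⇒≥)
import Data.Nat.Properties as ℕ
open import Data.Nat.Tactic.RingSolver using (solve-∀)
open import Data.Product using (∃-syntax; ∃₂; _,_; proj₁; proj₂)
open import Data.Sum using (_⊎_; inj₁; inj₂; [_,_]′)
open import Function.Base using (_∘_; id)
open import Function.Bundles using (mk⇔; Equivalence)
import Function.Properties.Equivalence as ⇔
open import Relation.Binary.Definitions using (Decidable)
open import Relation.Nullary using (¬_; yes; no)
import Relation.Nullary.Decidable as Dec
open import Relation.Binary.PropositionalEquality as ≡
  using (cong; cong₂; subst; module ≡-Reasoning)

-- Γ is undirected iff its connection set S is closed under negation.  Writing
-- −1 = (α₁^e₁, α₂^e₂), negation adds (e₁, e₂) to the exponents, so it always
-- preserves C₁, and it preserves D₀ iff e₁ ≡ e₂ (mod m); testing (1, 1) ∈ D₀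
-- shows that this condition is also necessary.  Since αᵢ has order m nᵢ, one
-- may take eᵢ = m nᵢ / 2 when m nᵢ is even and eᵢ = 0 when it is odd (then
-- −1 = 1), and in every case eᵢ mod m is m/2 if qᵢ nᵢ is odd and 0 otherwise.

module _ {m : ℕ} .{{_ : NonZero m}} where

  ∣∸⇔%≡% : ∀ {a b} → a ≤ b → m ∣ b ∸ a ⇔ a % m ≡ b % m
  ∣∸⇔%≡% {a} {b} a≤b = mk⇔ to from
    where
    open ≡-Reasoning

    to : m ∣ b ∸ a → a % m ≡ b % m
    to m∣b∸a = begin
      a % m           ≡⟨ %-remove-+ˡ a m∣b∸a ⟨
      (b ∸ a + a) % m ≡⟨ cong (_% m) (m∸n+n≡m a≤b) ⟩
      b % m           ∎

    from : a % m ≡ b % m → m ∣ b ∸ a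
    from a%m≡b%m = divides (b / m ∸ a / m) (begin
      b ∸ a                                     ≡⟨ cong₂ _∸_ (m≡m%n+[m/n]*n b m) (m≡m%n+[m/n]*n a m) ⟩
      (b % m + b / m * m) ∸ (a % m + a / m * m) ≡⟨ cong (λ r → (r + b / m * m) ∸ (a % m + a / m * m)) a%m≡b%m ⟨
      (a % m + b / m * m) ∸ (a % m + a / m * m) ≡⟨ [m+n]∸[m+o]≡n∸o (a % m) (b / m * m) (a / m * m) ⟩
      b / m * m ∸ a / m * m                     ≡⟨ *-distribʳ-∸ m (b / m) (a / m) ⟨
      (b / m ∸ a / m) * m                       ∎)

  ≤⇒≡[mod]⇔%≡% : ∀ {a b} → a ≤ b → a ≡ b [mod m ] ⇔ a % m ≡ b % m
  ≤⇒≡[mod]⇔%≡% {a} {b} a≤b =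
    mk⇔ (to ∘ subst (m ∣_) ∣a-b∣≡b∸a) (subst (m ∣_) (≡.sym ∣a-b∣≡b∸a) ∘ from)
    where
    open Equivalence (∣∸⇔%≡% a≤b)
    ∣a-b∣≡b∸a : ℤ.∣ + a ℤ.- + b ∣ ≡ b ∸ a
    ∣a-b∣≡b∸a = ≡.trans (cong ℤ.∣_∣ (ℤ.[+m]-[+n]≡m⊖n a b)) (ℤ.∣⊖∣-≤ a≤b)

  ≡[mod]-sym : ∀ {a b} → a ≡ b [mod m ] → b ≡ a [mod m ]
  ≡[mod]-sym {a} {b} = subst (m ∣_) (ℤ.∣i-j∣≡∣j-i∣ (+ a) (+ b))

  ≡[mod]⇔%≡% : ∀ a b → a ≡ b [mod m ] ⇔ a % m ≡ b % m
  ≡[mod]⇔%≡% a b with ≤-total a b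
  ... | inj₁ a≤b = ≤⇒≡[mod]⇔%≡% a≤b
  ... | inj₂ b≤a = mk⇔ (≡.sym ∘ to ∘ ≡[mod]-sym {a} {b}) (≡[mod]-sym {b} {a} ∘ from ∘ ≡.sym)
    where open Equivalence (≤⇒≡[mod]⇔%≡% b≤a)

  %≡%-+ : ∀ {a b c d} → a % m ≡ b % m → c % m ≡ d % m → (a + c) % m ≡ (b + d) % m
  %≡%-+ {a} {b} {c} {d} a≡b c≡d = begin
    (a + c) % m             ≡⟨ %-distribˡ-+ a c m ⟩
    (a % m + c % m) % m     ≡⟨ cong₂ (λ x y → (x + y) % m) a≡b c≡d ⟩
    (b % m + d % m) % m     ≡⟨ %-distribˡ-+ b d m ⟨
    (b + d) % m             ∎
    where open ≡-Reasoning

data Parity : ℕ → Set where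
  even : ∀ k → Parity (k + k)
  odd  : ∀ k → Parity (suc (k + k))

parity : ∀ n → Parity n
parity zero = even 0
parity (suc n) with parity n
... | even k = odd k
... | odd k  = subst Parity (cong suc (+-suc k k)) (even (suc k))

k+k≡k*2 : ∀ k → k + k ≡ k * 2
k+k≡k*2 k = ≡.trans (cong (_+_ k) (≡.sym (ℕ.+-identityʳ k))) (ℕ.*-comm 2 k)

[k+k]%2≡0 : ∀ k → (k + k) % 2 ≡ 0
[k+k]%2≡0 k = ≡.trans (cong (_% 2) (k+k≡k*2 k)) (m*n%n≡0 k 2)

[1+k+k]%2≡1 : ∀ k → suc (k + k) % 2 ≡ 1
[1+k+k]%2≡1 k = ≡.trans (cong (λ x → suc x % 2) (k+k≡k*2 k)) ([m+kn]%n≡m%n 1 k 2)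

x*[k+k]%2≡0 : ∀ x k → (x * (k + k)) % 2 ≡ 0
x*[k+k]%2≡0 x k = ≡.trans (cong (_% 2) (*-distribˡ-+ x k k)) ([k+k]%2≡0 (x * k))

[k+k]*x%2≡0 : ∀ k x → ((k + k) * x) % 2 ≡ 0
[k+k]*x%2≡0 k x = ≡.trans (cong (_% 2) (*-distribʳ-+ x k k)) ([k+k]%2≡0 (k * x))

multiples-≡⇔factors-≡ : ∀ {x₁ x₂ p₁ p₂ h} .{{_ : NonZero h}} → x₁ ≡ p₁ * h → x₂ ≡ p₂ * h
  → x₁ ≡ x₂ ⇔ p₁ ≡ p₂
multiples-≡⇔factors-≡ {h = h} x₁≡p₁h x₂≡p₂h = mk⇔
  (λ x₁≡x₂ → *-cancelʳ-≡ _ _ h (≡.trans (≡.sym x₁≡p₁h) (≡.trans x₁≡x₂ x₂≡p₂h)))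
  (λ p₁≡p₂ → ≡.trans x₁≡p₁h (≡.trans (cong (_* h) p₁≡p₂) (≡.sym x₂≡p₂h)))

odd*odd : ∀ j k → suc (j + j) * suc (k + k) ≡ suc ((k + j * suc (k + k)) + (k + j * suc (k + k)))
odd*odd = solve-∀

a*[1+b+b]≡a+b*[a+a] : ∀ a b → a * suc (b + b) ≡ a + b * (a + a)
a*[1+b+b]≡a+b*[a+a] = solve-∀

1<k+k⇒0<k : ∀ {k} → 1 < k + k → 0 < k
1<k+k⇒0<k {suc _} _ = z<s

odd-coprime-2 : ∀ k → Coprime (suc (k + k)) 2
odd-coprime-2 zero    = 1-coprimeTo 2
odd-coprime-2 (suc k) =
  subst (λ n → Coprime n 2) (cong suc (≡.sym (+-suc (suc k) k))) (coprime-+ (odd-coprime-2 k))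

module FiniteFieldProperties {q : ℕ} (F : FiniteField q) where
  open FiniteField F hiding (zero) renaming (_+_ to _⊕_; _*_ to _⊗_)
  open RingProperties ring using (-‿involutive; -0#≈0#; +-inverseˡ-unique; -1*x≈-x)
  open import Relation.Binary.Reasoning.Setoid setoid

  infix 4 _≈?_
  _≈?_ : Decidable _≈_
  x ≈? y with enum-surjective x | enum-surjective y
  ... | i , i↦x | j , j↦y =
    Dec.map′ (λ { ≡.refl → trans (sym i↦x) j↦y })
             (λ x≈y → enum-injective i j (trans i↦x (trans x≈y (sym j↦y))))
             (i Fin.≟ j)

  *-cancelˡ : ∀ {z x y} → ¬ z ≈ 0# → z ⊗ x ≈ z ⊗ y → x ≈ y
  *-cancelˡ {z} {x} {y} z≉0 zx≈zy with inverse z z≉0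
  ... | z⁻¹ , zz⁻¹≈1 = begin
    x              ≈⟨ z⁻¹[zw]≈w x ⟨
    z⁻¹ ⊗ (z ⊗ x)  ≈⟨ *-congˡ zx≈zy ⟩
    z⁻¹ ⊗ (z ⊗ y)  ≈⟨ z⁻¹[zw]≈w y ⟩
    y              ∎
    where
    z⁻¹[zw]≈w : ∀ w → z⁻¹ ⊗ (z ⊗ w) ≈ w
    z⁻¹[zw]≈w w = begin
      z⁻¹ ⊗ (z ⊗ w) ≈⟨ *-assoc z⁻¹ z w ⟨
      z⁻¹ ⊗ z ⊗ w   ≈⟨ *-congʳ (trans (*-comm z⁻¹ z) zz⁻¹≈1) ⟩
      1# ⊗ w        ≈⟨ *-identityˡ w ⟩
      w             ∎

  x*y≉0 : ∀ {x y} → ¬ x ≈ 0# → ¬ y ≈ 0# → ¬ x ⊗ y ≈ 0#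
  x*y≉0 {x} x≉0 y≉0 xy≈0 = y≉0 (*-cancelˡ x≉0 (trans xy≈0 (sym (zeroʳ x))))

  -1≉0 : ¬ - 1# ≈ 0#
  -1≉0 -1≈0 = 1≉0 (trans (sym (-‿involutive 1#)) (trans (-‿cong -1≈0) -0#≈0#))

  x*x≈1⇒x≈1⊎x≈-1 : ∀ {x} → x ⊗ x ≈ 1# → x ≈ 1# ⊎ x ≈ - 1#
  x*x≈1⇒x≈1⊎x≈-1 {x} x*x≈1 with x ⊕ 1# ≈? 0#
  ... | yes x+1≈0 = inj₂ (+-inverseˡ-unique x 1# x+1≈0)
  ... | no  x+1≉0 = inj₁ (*-cancelˡ x+1≉0 (begin
    (x ⊕ 1#) ⊗ x    ≈⟨ distribʳ x x 1# ⟩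
    x ⊗ x ⊕ 1# ⊗ x  ≈⟨ +-cong x*x≈1 (*-identityˡ x) ⟩
    1# ⊕ x          ≈⟨ +-comm 1# x ⟩
    x ⊕ 1#          ≈⟨ *-identityʳ (x ⊕ 1#) ⟨
    (x ⊕ 1#) ⊗ 1#   ∎))

  h≈s+g⇒g≈-s+h : ∀ {g h s} → h ≈ s ⊕ g → g ≈ - s ⊕ h
  h≈s+g⇒g≈-s+h {g} {h} {s} h≈s+g = sym (begin
    - s ⊕ h        ≈⟨ +-congˡ h≈s+g ⟩
    - s ⊕ (s ⊕ g)  ≈⟨ +-assoc (- s) s g ⟨
    - s ⊕ s ⊕ g    ≈⟨ +-congʳ (-‿inverseˡ s) ⟩
    0# ⊕ g         ≈⟨ +-identityˡ g ⟩
    g              ∎)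

  pow-homo-* : ∀ x a b → pow x (a + b) ≈ pow x a ⊗ pow x b
  pow-homo-* x zero  b = sym (*-identityˡ (pow x b))
  pow-homo-* x (suc a) b = trans (*-congˡ (pow-homo-* x a b)) (sym (*-assoc x (pow x a) (pow x b)))

  pow-*-period : ∀ {x k} → pow x k ≈ 1# → ∀ j → pow x (j * k) ≈ 1#
  pow-*-period x^k≈1 zero = refl
  pow-*-period {x} {k} x^k≈1 (suc j) = begin
    pow x (k + j * k)        ≈⟨ pow-homo-* x k (j * k) ⟩
    pow x k ⊗ pow x (j * k)  ≈⟨ *-cong x^k≈1 (pow-*-period x^k≈1 j) ⟩
    1# ⊗ 1#                  ≈⟨ *-identityˡ 1# ⟩
    1#                       ∎

  pow-%-period : ∀ {x k} .{{_ : NonZero k}} → pow x k ≈ 1# → ∀ a → pow x a ≈ pow x (a % k)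
  pow-%-period {x} {k} x^k≈1 a = begin
    pow x a                             ≡⟨ cong (pow x) (m≡m%n+[m/n]*n a k) ⟩
    pow x (a % k + a / k * k)           ≈⟨ pow-homo-* x (a % k) (a / k * k) ⟩
    pow x (a % k) ⊗ pow x (a / k * k)   ≈⟨ *-congˡ (pow-*-period x^k≈1 (a / k)) ⟩
    pow x (a % k) ⊗ 1#                  ≈⟨ *-identityʳ (pow x (a % k)) ⟩
    pow x (a % k)                       ∎

  -‿pow : ∀ β e a {x} → - 1# ≈ pow β e → x ≈ pow β a → - x ≈ pow β (e + a)
  -‿pow β e a {x} -1≈β^e x≈β^a = begin
    - x                ≈⟨ -1*x≈-x x ⟨
    - 1# ⊗ x           ≈⟨ *-cong -1≈β^e x≈β^a ⟩
    pow β e ⊗ pow β a  ≈⟨ pow-homo-* β e a ⟨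
    pow β (e + a)      ∎

  surjective⇒q≤ : ∀ {k} (g : Fin k → Carrier) → (∀ x → ∃[ i ] (g i ≈ x)) → q ≤ k
  surjective⇒q≤ {k} g surjective = ≮⇒≥ k≮q
    where
    h : Fin q → Fin k
    h i = proj₁ (surjective (enum i))

    k≮q : ¬ k < q
    k≮q k<q with Fin.pigeonhole k<q h
    ... | i , j , i<j , hi≡hj = Fin.<⇒≢ i<j (enum-injective i j (begin
      enum i      ≈⟨ surjective (enum i) .proj₂ ⟨
      g (h i)     ≡⟨ cong g hi≡hj ⟩
      g (h j)     ≈⟨ surjective (enum j) .proj₂ ⟩
      enum j      ∎))

  pigeonhole : (g : Fin (suc q) → Carrier) → ∃₂ λ i j → i Fin.< j × g i ≈ g j
  pigeonhole g with Fin.pigeonhole (n<1+n q) (λ i → proj₁ (enum-surjective (g i)))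
  ... | i , j , i<j , hi≡hj = i , j , i<j , (begin
    g i                               ≈⟨ enum-surjective (g i) .proj₂ ⟨
    enum (proj₁ (enum-surjective (g i))) ≡⟨ cong enum hi≡hj ⟩
    enum (proj₁ (enum-surjective (g j))) ≈⟨ enum-surjective (g j) .proj₂ ⟩
    g j                               ∎)

  0∷powers : Carrier → ∀ {k} → Fin (suc k) → Carrier
  0∷powers β zero    = 0#
  0∷powers β (suc j) = pow β (toℕ j)

  powers-cover⇒q≤1+k : ∀ {β k} → (∀ x → ¬ x ≈ 0# → ∃[ j ] (j < k × x ≈ pow β j)) → q ≤ suc k
  powers-cover⇒q≤1+k {β} {k} cover = surjective⇒q≤ (0∷powers β) surjective
    where
    surjective : ∀ x → ∃[ i ] (0∷powers β {k} i ≈ x)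
    surjective x with x ≈? 0#
    ... | yes x≈0 = zero , sym x≈0
    ... | no  x≉0 with cover x x≉0
    ...   | j , j<k , x≈β^j =
      suc (fromℕ< j<k) , trans (reflexive (cong (pow β) (Fin.toℕ-fromℕ< j<k))) (sym x≈β^j)

module PrimitiveElement {N : ℕ} (F : FiniteField (suc N)) {α : FiniteField.Carrier F}
                        (α-primitive : FiniteField.IsPrimitive F α) (1<N : 1 < N) where
  open FiniteField F hiding (zero) renaming (_+_ to _⊕_; _*_ to _⊗_)
  open FiniteFieldProperties F
  open RingProperties ring using (-‿involutive; -1*x≈-x)
  open import Relation.Binary.Reasoning.Setoid setoid

  instance
    N≢0 : NonZero N
    N≢0 = >-nonZero (<-trans z<s 1<N)

  -- Over GF(2) also IsPrimitive 0# holds; this is why 1 < N is assumed.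
  α≉0 : ¬ α ≈ 0#
  α≉0 α≈0 = <⇒≱ 1<N (s≤s⁻¹ (powers-cover⇒q≤1+k cover))
    where
    cover : ∀ x → ¬ x ≈ 0# → ∃[ j ] (j < 1 × x ≈ pow α j)
    cover x x≉0 with α-primitive x x≉0
    ... | zero , x≈1   = 0 , z<s , x≈1
    ... | suc k  , x≈α^k = ⊥-elim (x≉0 (trans x≈α^k (trans (*-congʳ α≈0) (zeroˡ (pow α k)))))

  α^k≉0 : ∀ k → ¬ pow α k ≈ 0#
  α^k≉0 zero  = 1≉0
  α^k≉0 (suc k) = x*y≉0 α≉0 (α^k≉0 k)

  α^d≈1⇒N≤d : ∀ {d} → 0 < d → pow α d ≈ 1# → N ≤ d
  α^d≈1⇒N≤d {d} 0<d α^d≈1 = s≤s⁻¹ (powers-cover⇒q≤1+k cover)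
    where
    instance
      d≢0 : NonZero d
      d≢0 = >-nonZero 0<d
    cover : ∀ x → ¬ x ≈ 0# → ∃[ j ] (j < d × x ≈ pow α j)
    cover x x≉0 with α-primitive x x≉0
    ... | a , x≈α^a = a % d , m%n<n a d , trans x≈α^a (pow-%-period α^d≈1 a)

  α^a≈α^b⇒α^[b∸a]≈1 : ∀ {a b} → a ≤ b → pow α a ≈ pow α b → pow α (b ∸ a) ≈ 1#
  α^a≈α^b⇒α^[b∸a]≈1 {a} {b} a≤b α^a≈α^b = *-cancelˡ (α^k≉0 a) (begin
    pow α a ⊗ pow α (b ∸ a)  ≈⟨ pow-homo-* α a (b ∸ a) ⟨
    pow α (a + (b ∸ a))      ≡⟨ cong (pow α) (m+[n∸m]≡n a≤b) ⟩
    pow α b                  ≈⟨ α^a≈α^b ⟨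
    pow α a                  ≈⟨ *-identityʳ (pow α a) ⟨
    pow α a ⊗ 1#             ∎)

  -- Among 0, α⁰, …, α^N two of the q + 1 entries coincide, necessarily two powers.
  α^N≈1 : pow α N ≈ 1#
  α^N≈1 with pigeonhole (0∷powers α)
  ... | _     , zero  , () , _
  ... | zero  , suc j , _  , 0≈α^j = ⊥-elim (α^k≉0 (toℕ j) (sym 0≈α^j))
  ... | suc i , suc j , s≤s i<j , α^i≈α^j = subst (λ d → pow α d ≈ 1#) d≡N α^d≈1
    where
    α^d≈1 : pow α (toℕ j ∸ toℕ i) ≈ 1#
    α^d≈1 = α^a≈α^b⇒α^[b∸a]≈1 (<⇒≤ i<j) α^i≈α^j
    d≡N : toℕ j ∸ toℕ i ≡ N
    d≡N = ≤-antisym (≤-trans (m∸n≤m (toℕ j) (toℕ i)) (s≤s⁻¹ (Fin.toℕ<n j)))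
                    (α^d≈1⇒N≤d (m<n⇒0<n∸m i<j) α^d≈1)

  α^a≈α^[a%N] : ∀ a → pow α a ≈ pow α (a % N)
  α^a≈α^[a%N] = pow-%-period α^N≈1

  α^-injective-≤ : ∀ {a b} → a ≤ b → b < N → pow α a ≈ pow α b → a ≡ b
  α^-injective-≤ {a} {b} a≤b b<N α^a≈α^b = ≤-antisym a≤b (≮⇒≥ a≮b)
    where
    a≮b : ¬ a < b
    a≮b a<b = <⇒≱ b<N (≤-trans (α^d≈1⇒N≤d (m<n⇒0<n∸m a<b) (α^a≈α^b⇒α^[b∸a]≈1 a≤b α^a≈α^b))
                                (m∸n≤m b a))

  α^-injective-< : ∀ {a b} → a < N → b < N → pow α a ≈ pow α b → a ≡ b
  α^-injective-< {a} {b} a<N b<N α^a≈α^b with ≤-total a b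
  ... | inj₁ a≤b = α^-injective-≤ a≤b b<N α^a≈α^b
  ... | inj₂ b≤a = ≡.sym (α^-injective-≤ b≤a a<N (sym α^a≈α^b))

  α^a≈α^b⇒a%N≡b%N : ∀ {a b} → pow α a ≈ pow α b → a % N ≡ b % N
  α^a≈α^b⇒a%N≡b%N {a} {b} α^a≈α^b = α^-injective-< (m%n<n a N) (m%n<n b N)
    (trans (sym (α^a≈α^[a%N] a)) (trans α^a≈α^b (α^a≈α^[a%N] b)))

  α^a≈α^b⇒a%m≡b%m : ∀ {m} .{{_ : NonZero m}} → m ∣ N → ∀ {a b} → pow α a ≈ pow α b → a % m ≡ b % m
  α^a≈α^b⇒a%m≡b%m {m} m∣N {a} {b} α^a≈α^b =
    ≡.trans (≡.sym (m∣n⇒o%n%m≡o%m m N a m∣N))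
            (≡.trans (cong (_% m) (α^a≈α^b⇒a%N≡b%N α^a≈α^b)) (m∣n⇒o%n%m≡o%m m N b m∣N))

  α^a≈α^[k≤q-2] : ∀ a → ∃[ k ] (k ≤ suc N ∸ 2 × pow α a ≈ pow α k)
  α^a≈α^[k≤q-2] a = a % N , ∸-monoˡ-≤ 1 (m%n<n a N) , α^a≈α^[a%N] a

  -1≈α^t : ∀ t → N ≡ t + t → - 1# ≈ pow α t
  -1≈α^t t N≡t+t = sym ([ ⊥-elim ∘ α^t≉1 , id ]′ (x*x≈1⇒x≈1⊎x≈-1 α^t*α^t≈1))
    where
    α^t*α^t≈1 : pow α t ⊗ pow α t ≈ 1#
    α^t*α^t≈1 = trans (sym (pow-homo-* α t t)) (subst (λ d → pow α d ≈ 1#) N≡t+t α^N≈1)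
    0<t : 0 < t
    0<t = 1<k+k⇒0<k (subst (1 <_) N≡t+t 1<N)
    α^t≉1 : ¬ pow α t ≈ 1#
    α^t≉1 α^t≈1 = <⇒≱ (subst (t <_) (≡.sym N≡t+t) (m<m+n t 0<t)) (α^d≈1⇒N≤d 0<t α^t≈1)

  -1≈1 : ∀ t → N ≡ suc (t + t) → - 1# ≈ 1#
  -1≈1 t N≡1+2t with α-primitive (- 1#) -1≉0
  ... | k , -1≈α^k = begin
    - 1#           ≈⟨ -1≈α^k ⟩
    pow α k        ≈⟨ α^a≈α^[a%N] k ⟩
    pow α (k % N)  ≡⟨ cong (pow α) (n∣m⇒m%n≡0 k N N∣k) ⟩
    1#             ∎
    where
    α^[k+k]≈α^N : pow α (k + k) ≈ pow α N
    α^[k+k]≈α^N = begin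
      pow α (k + k)      ≈⟨ pow-homo-* α k k ⟩
      pow α k ⊗ pow α k  ≈⟨ *-cong -1≈α^k -1≈α^k ⟨
      - 1# ⊗ - 1#        ≈⟨ -1*x≈-x (- 1#) ⟩
      - - 1#             ≈⟨ -‿involutive 1# ⟩
      1#                 ≈⟨ α^N≈1 ⟨
      pow α N            ∎
    N∣2k : N ∣ 2 * k
    N∣2k = m%n≡0⇒n∣m (2 * k) N
      (≡.trans (cong (λ x → (k + x) % N) (ℕ.+-identityʳ k))
               (≡.trans (α^a≈α^b⇒a%N≡b%N α^[k+k]≈α^N) (n%n≡0 N)))
    N∣k : N ∣ k
    N∣k = coprime-divisor (subst (λ n → Coprime n 2) (≡.sym N≡1+2t) (odd-coprime-2 t)) N∣2k

-1-exponent : ∀ m n .{{_ : NonZero m}} → 2 ≤ m → 1 ≤ n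
  → (F : FiniteField (suc (m * n))) {α : FiniteField.Carrier F} → FiniteField.IsPrimitive F α
  → let open FiniteField F using (_≈_; -_; 1#; pow) in
    ∃[ e ] (- 1# ≈ pow α e × e % m ≡ (suc (m * n) * n) % 2 * (m / 2))
-1-exponent m n 2≤m 1≤n F α-primitive with parity n
... | even b = m * b , -1≈α^t (m * b) (*-distribˡ-+ m b b) , (begin
  m * b % m                                ≡⟨ cong (_% m) (ℕ.*-comm m b) ⟩
  b * m % m                                ≡⟨ m*n%n≡0 b m ⟩
  0 * (m / 2)                              ≡⟨ cong (_* (m / 2)) (x*[k+k]%2≡0 (suc (m * (b + b))) b) ⟨
  (suc (m * (b + b)) * (b + b)) % 2 * (m / 2) ∎)
  where
  open PrimitiveElement F α-primitive (*-mono-≤ 2≤m 1≤n)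
  open ≡-Reasoning
... | odd b with parity m
...   | even a = a * s , -1≈α^t (a * s) (*-distribʳ-+ s a a) , (begin
  a * s % (a + a)                          ≡⟨ cong (_% (a + a)) (a*[1+b+b]≡a+b*[a+a] a b) ⟩
  (a + b * (a + a)) % (a + a)              ≡⟨ [m+kn]%n≡m%n a b (a + a) ⟩
  a % (a + a)                              ≡⟨ m<n⇒m%n≡m (m<m+n a 0<a) ⟩
  a                                        ≡⟨ ℕ.*-identityˡ a ⟨
  1 * a                                    ≡⟨ cong₂ _*_ q*s%2≡1 [a+a]/2≡a ⟨
  (suc ((a + a) * s) * s) % 2 * ((a + a) / 2) ∎)
  where
  open PrimitiveElement F α-primitive (*-mono-≤ 2≤m 1≤n)
  open ≡-Reasoning
  s = suc (b + b)
  0<a : 0 < a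
  0<a = 1<k+k⇒0<k 2≤m
  q*s%2≡1 : (suc ((a + a) * s) * s) % 2 ≡ 1
  q*s%2≡1 = ≡.trans (cong (λ x → (suc x * s) % 2) (*-distribʳ-+ s a a))
                  (≡.trans (cong (_% 2) (odd*odd (a * s) b)) ([1+k+k]%2≡1 (b + a * s * s)))
  [a+a]/2≡a : (a + a) / 2 ≡ a
  [a+a]/2≡a = ≡.trans (cong (_/ 2) (k+k≡k*2 a)) (m*n/n≡m a 2)
...   | odd a = 0 , -1≈1 c (odd*odd a b) ,
  ≡.sym (cong (_* (m / 2)) (begin
    (suc (suc (a + a) * s) * s) % 2 ≡⟨ cong (λ x → (x * s) % 2) q≡c+c ⟩
    ((suc c + suc c) * s) % 2       ≡⟨ [k+k]*x%2≡0 (suc c) s ⟩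
    0                               ∎))
  where
  open PrimitiveElement F α-primitive (*-mono-≤ 2≤m 1≤n)
  open ≡-Reasoning
  s = suc (b + b)
  c = b + a * s
  q≡c+c : suc (suc (a + a) * s) ≡ suc c + suc c
  q≡c+c = ≡.trans (cong suc (odd*odd a b)) (cong suc (≡.sym (+-suc c c)))

module _ {q₁ q₂ : ℕ} (F₁ : FiniteField q₁) (F₂ : FiniteField q₂) (m : ℕ) .{{_ : NonZero m}}
         {α₁ : FiniteField.Carrier F₁} {α₂ : FiniteField.Carrier F₂} {e₁ e₂ : ℕ} where
  private
    module F₁ = FiniteField F₁
    module F₂ = FiniteField F₂
    module P₁ = FiniteFieldProperties F₁
    module P₂ = FiniteFieldProperties F₂
    module R₁ = RingProperties F₁.ring
    module R₂ = RingProperties F₂.ring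

  undirected⇒e₁%m≡e₂%m : F₁.- F₁.1# F₁.≈ F₁.pow α₁ e₁ → F₂.- F₂.1# F₂.≈ F₂.pow α₂ e₂
    → (∀ {a b} → F₁.pow α₁ a F₁.≈ F₁.pow α₁ b → a % m ≡ b % m)
    → (∀ {a b} → F₂.pow α₂ a F₂.≈ F₂.pow α₂ b → a % m ≡ b % m)
    → Undirected F₁ F₂ m α₁ α₂ → e₁ % m ≡ e₂ % m
  undirected⇒e₁%m≡e₂%m -1≈α₁^e₁ -1≈α₂^e₂ α₁-injective α₂-injective undirected
    with undirected (F₁.0# , F₂.0#) (F₁.1# , F₂.1#) ((F₁.1# , F₂.1#) , [1,1]∈S , 1+0≈1)
    where
    [1,1]∈S : InS F₁ F₂ m α₁ α₂ (F₁.1# , F₂.1#)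
    [1,1]∈S = inj₂ (0 , 0 , Equivalence.from (≡[mod]⇔%≡% 0 0) ≡.refl , F₁.refl , F₂.refl)
    1+0≈1 = F₁.sym (F₁.+-identityʳ F₁.1#) , F₂.sym (F₂.+-identityʳ F₂.1#)
  ... | (s₁ , s₂) , inj₁ (_ , _ , _ , s₂≈0) , (_ , 0≈s₂+1) =
    ⊥-elim (P₂.-1≉0 (F₂.trans (F₂.sym (R₂.+-inverseˡ-unique s₂ F₂.1# (F₂.sym 0≈s₂+1))) s₂≈0))
  ... | (s₁ , s₂) , inj₂ (i₁ , i₂ , i₁≡i₂ , s₁≈α₁^i₁ , s₂≈α₂^i₂) , (0≈s₁+1 , 0≈s₂+1) = begin
    e₁ % m  ≡⟨ α₁-injective (F₁.trans (F₁.sym -1≈α₁^e₁) (F₁.trans (F₁.sym s₁≈-1) s₁≈α₁^i₁)) ⟩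
    i₁ % m  ≡⟨ Equivalence.to (≡[mod]⇔%≡% i₁ i₂) i₁≡i₂ ⟩
    i₂ % m  ≡⟨ α₂-injective (F₂.trans (F₂.sym s₂≈α₂^i₂) (F₂.trans s₂≈-1 -1≈α₂^e₂)) ⟩
    e₂ % m  ∎
    where
    open ≡-Reasoning
    s₁≈-1 = R₁.+-inverseˡ-unique s₁ F₁.1# (F₁.sym 0≈s₁+1)
    s₂≈-1 = R₂.+-inverseˡ-unique s₂ F₂.1# (F₂.sym 0≈s₂+1)

  e₁%m≡e₂%m⇒undirected : F₁.- F₁.1# F₁.≈ F₁.pow α₁ e₁ → F₂.- F₂.1# F₂.≈ F₂.pow α₂ e₂
    → (∀ a → ∃[ k ] (k ≤ q₁ ∸ 2 × F₁.pow α₁ a F₁.≈ F₁.pow α₁ k))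
    → e₁ % m ≡ e₂ % m → Undirected F₁ F₂ m α₁ α₂
  e₁%m≡e₂%m⇒undirected -1≈α₁^e₁ -1≈α₂^e₂ reduce e₁≡e₂ g h ((s₁ , s₂) , s∈S , (h₁≈ , h₂≈)) =
    (F₁.- s₁ , F₂.- s₂) , -s∈S s∈S , (P₁.h≈s+g⇒g≈-s+h h₁≈ , P₂.h≈s+g⇒g≈-s+h h₂≈)
    where
    -s∈S : ∀ {s₁ s₂} → InS F₁ F₂ m α₁ α₂ (s₁ , s₂) → InS F₁ F₂ m α₁ α₂ (F₁.- s₁ , F₂.- s₂)
    -s∈S (inj₁ (k , _ , s₁≈α₁^k , s₂≈0)) with reduce (e₁ + k)
    ... | k′ , k′≤q₁-2 , α₁^[e₁+k]≈α₁^k′ =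
      inj₁ (k′ , k′≤q₁-2 , F₁.trans (P₁.-‿pow α₁ e₁ k -1≈α₁^e₁ s₁≈α₁^k) α₁^[e₁+k]≈α₁^k′ ,
            F₂.trans (F₂.-‿cong s₂≈0) R₂.-0#≈0#)
    -s∈S (inj₂ (i₁ , i₂ , i₁≡i₂ , s₁≈α₁^i₁ , s₂≈α₂^i₂)) =
      inj₂ (e₁ + i₁ , e₂ + i₂ ,
            Equivalence.from (≡[mod]⇔%≡% _ _) (%≡%-+ e₁≡e₂ (Equivalence.to (≡[mod]⇔%≡% i₁ i₂) i₁≡i₂)) ,
            P₁.-‿pow α₁ e₁ i₁ -1≈α₁^e₁ s₁≈α₁^i₁ , P₂.-‿pow α₂ e₂ i₂ -1≈α₂^e₂ s₂≈α₂^i₂)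

  undirected⇔e₁%m≡e₂%m : F₁.- F₁.1# F₁.≈ F₁.pow α₁ e₁ → F₂.- F₂.1# F₂.≈ F₂.pow α₂ e₂
    → (∀ {a b} → F₁.pow α₁ a F₁.≈ F₁.pow α₁ b → a % m ≡ b % m)
    → (∀ {a b} → F₂.pow α₂ a F₂.≈ F₂.pow α₂ b → a % m ≡ b % m)
    → (∀ a → ∃[ k ] (k ≤ q₁ ∸ 2 × F₁.pow α₁ a F₁.≈ F₁.pow α₁ k))
    → Undirected F₁ F₂ m α₁ α₂ ⇔ e₁ % m ≡ e₂ % m
  undirected⇔e₁%m≡e₂%m -1≈α₁^e₁ -1≈α₂^e₂ α₁-injective α₂-injective reduce = mk⇔
    (undirected⇒e₁%m≡e₂%m -1≈α₁^e₁ -1≈α₂^e₂ α₁-injective α₂-injective)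
    (e₁%m≡e₂%m⇒undirected -1≈α₁^e₁ -1≈α₂^e₂ reduce)

lemma3p5 : (m n₁ n₂ q₁ q₂ : ℕ) → 2 ≤ m → 1 ≤ n₁ → 1 ≤ n₂
    → q₁ ≡ 1 + m * n₁ → q₂ ≡ 1 + m * n₂
    → IsPrimePower q₁ → IsPrimePower q₂
    → (F₁ : FiniteField q₁) (F₂ : FiniteField q₂)
    → (α₁ : FiniteField.Carrier F₁) (α₂ : FiniteField.Carrier F₂)
    → FiniteField.IsPrimitive F₁ α₁ → FiniteField.IsPrimitive F₂ α₂
    → Undirected F₁ F₂ m α₁ α₂ ⇔ ((q₁ * n₁) % 2 ≡ (q₂ * n₂) % 2)
lemma3p5 m n₁ n₂ _ _ 2≤m 1≤n₁ 1≤n₂ ≡.refl ≡.refl _ _ F₁ F₂ α₁ α₂ α-primitive₁ α-primitive₂ =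
  let (e₁ , -1≈α₁^e₁ , e₁%m≡p₁*m/2) = -1-exponent m n₁ 2≤m 1≤n₁ F₁ α-primitive₁
      (e₂ , -1≈α₂^e₂ , e₂%m≡p₂*m/2) = -1-exponent m n₂ 2≤m 1≤n₂ F₂ α-primitive₂
  in ⇔.trans
       (undirected⇔e₁%m≡e₂%m F₁ F₂ m -1≈α₁^e₁ -1≈α₂^e₂
          (A₁.α^a≈α^b⇒a%m≡b%m (m∣m*n n₁)) (A₂.α^a≈α^b⇒a%m≡b%m (m∣m*n n₂)) A₁.α^a≈α^[k≤q-2])
       (multiples-≡⇔factors-≡ e₁%m≡p₁*m/2 e₂%m≡p₂*m/2)
  where
  instance
    m≢0 : NonZero m
    m≢0 = >-nonZero (<-trans z<s 2≤m)
    m/2≢0 : NonZero (m / 2)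
    m/2≢0 = >-nonZero (m≥n⇒m/n>0 2≤m)
  module A₁ = PrimitiveElement F₁ α-primitive₁ (*-mono-≤ 2≤m 1≤n₁)
  module A₂ = PrimitiveElement F₂ α-primitive₂ (*-mono-≤ 2≤m 1≤n₂)
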